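{- Let $G$ be a connected graph with maximum degree $\Delta(G)\leq d$, and let $(T,\mathcal{Y})$ be a tree-decomposition of $G$ of width at most $w$ satisfying property (W5). Then $\Delta(T)\leq (w+1)d$.
   Context: Graphs are finite and loopless but may have multiple edges. A tree-decomposition of $G$ is a pair $(T,\mathcal{Y})$ where $T$ is a tree and $\mathcal{Y}=\{Y_t\}_{t\in V(T)}$ is a family of subsets of $V(G)$ ("bags") such that (W1) $\bigcup_{t} Y_t=V(G)$ and every edge of $G$ has both ends in some $Y_t$; and (W2) if $t'$ lies on the path of $T$ between $t$ and $t''$ then $Y_t\cap Y_{t''}\subseteq Y_{t'}$. Its width is $\max_t(|Y_t|-1)$. Property (W5): for every $t_0\in V(T)$ and every component $B$ of $T-t_0$, the set $\bigcup_{t\in V(B)}Y_t\setminus Y_{t_0}$ is nonempty. -}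

module Defs where

open import Data.Nat using (ℕ; zero; suc; _≤_; _<_; _*_)
open import Data.Fin using (Fin; zero; suc; inject₁; fromℕ; _≟_)
open import Data.Fin.Subset using (Subset; _∈_; _∉_; ∣_∣)
open import Data.Fin.Subset.Properties using (_∈?_)
open import Data.Product using (Σ; ∃; ∃-syntax; _×_; _,_; proj₁; proj₂)
open import Data.Sum using (_⊎_; inj₁; inj₂)
open import Data.List using (List; length; filter)
open import Data.Fin.Base using () renaming (toℕ to finToℕ)
open import Data.List using (allFin)
open import Function.Definitions using (Injective)
open import Relation.Binary.PropositionalEquality using (_≡_; _≢_)
open import Relation.Binary.Construct.Closure.ReflexiveTransitive using (Star)
open import Relation.Nullary using (¬_; Dec; yes; no)
open import Relation.Nullary.Decidable using (_⊎-dec_)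

-- A finite loopless multigraph: vertices Fin nV, edges Fin nE,
-- each edge has an (ordered, but used unordered) pair of distinct ends.
record Multigraph : Set where
  field
    nV : ℕ
    nE : ℕ
    ends : Fin nE → Fin nV × Fin nV
    loopless : ∀ e → proj₁ (ends e) ≢ proj₂ (ends e)

open Multigraph public

Vertex : Multigraph → Set
Vertex G = Fin (nV G)

Edge : Multigraph → Set
Edge G = Fin (nE G)

Joins : (G : Multigraph) → Edge G → Vertex G → Vertex G → Set
Joins G e a b = (ends G e ≡ (a , b)) ⊎ (ends G e ≡ (b , a))

Adj : (G : Multigraph) → Vertex G → Vertex G → Set
Adj G a b = ∃[ e ] Joins G e a b

Incident : (G : Multigraph) → Vertex G → Edge G → Set
Incident G v e = (proj₁ (ends G e) ≡ v) ⊎ (proj₂ (ends G e) ≡ v)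

incident? : (G : Multigraph) → (v : Vertex G) → (e : Edge G) → Dec (Incident G v e)
incident? G v e = (proj₁ (ends G e) ≟ v) ⊎-dec (proj₂ (ends G e) ≟ v)

-- degree = number of edges incident with v (graphs are loopless,
-- so each incident edge contributes exactly 1; parallel edges counted)
degree : (G : Multigraph) → Vertex G → ℕ
degree G v = length (filter (incident? G v) (allFin (nE G)))

MaxDegree≤ : Multigraph → ℕ → Set
MaxDegree≤ G d = ∀ v → degree G v ≤ d

Reachable : (G : Multigraph) → Vertex G → Vertex G → Set
Reachable G = Star (Adj G)

Connected : Multigraph → Set
Connected G = (0 < nV G) × (∀ u v → Reachable G u v)

-- a cycle of length k+2 ≥ 2: distinct vertices vs 0 .. vs (k+1),
-- distinct edges es i joining vs i and vs (i+1), and es (k+1) joining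
-- vs (k+1) and vs 0.
record Cycle (G : Multigraph) : Set where
  field
    k : ℕ
    vs : Fin (suc (suc k)) → Vertex G
    es : Fin (suc (suc k)) → Edge G
    vs-inj : Injective _≡_ _≡_ vs
    es-inj : Injective _≡_ _≡_ es
    step : ∀ (i : Fin (suc k)) → Joins G (es (inject₁ i)) (vs (inject₁ i)) (vs (suc i))
    close : Joins G (es (fromℕ (suc k))) (vs (fromℕ (suc k))) (vs zero)

IsTree : Multigraph → Set
IsTree T = Connected T × ¬ Cycle T

record Path (G : Multigraph) (a b : Vertex G) : Set where
  field
    k : ℕ
    ps : Fin (suc k) → Vertex G
    ps-inj : Injective _≡_ _≡_ ps
    start : ps zero ≡ a
    end : ps (fromℕ k) ≡ b
    step : ∀ (i : Fin k) → Adj G (ps (inject₁ i)) (ps (suc i))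

OnPath : {G : Multigraph} {a b : Vertex G} → Path G a b → Vertex G → Set
OnPath P x = ∃[ i ] Path.ps P i ≡ x

record TreeDecomposition (G : Multigraph) : Set₁ where
  field
    T : Multigraph
    T-tree : IsTree T
    Y : Vertex T → Subset (nV G)
    W1-vertices : ∀ (v : Vertex G) → ∃[ t ] (v ∈ Y t)
    W1-edges : ∀ (e : Edge G) → ∃[ t ] ((proj₁ (ends G e) ∈ Y t) × (proj₂ (ends G e) ∈ Y t))
    W2 : ∀ (t t'' : Vertex T) (P : Path T t t'') (t' : Vertex T) → OnPath P t' →
         ∀ (v : Vertex G) → v ∈ Y t → v ∈ Y t'' → v ∈ Y t'

open TreeDecomposition public

-- width ≤ w, i.e. |Y_t| - 1 ≤ w for all t
Width≤ : {G : Multigraph} → TreeDecomposition G → ℕ → Set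
Width≤ D w = ∀ t → ∣ Y D t ∣ ≤ suc w

AdjAvoid : (T : Multigraph) → Vertex T → Vertex T → Vertex T → Set
AdjAvoid T t0 a b = Adj T a b × (a ≢ t0) × (b ≢ t0)

-- (W5): for every t0 and every component B of T - t0 (given by any of its
-- vertices t ≠ t0; B = vertices reachable from t in T - t0),
-- ⋃_{t' ∈ B} Y_{t'} \ Y_{t0} is nonempty.
W5 : {G : Multigraph} → TreeDecomposition G → Set
W5 {G} D = ∀ (t0 t : Vertex (T D)) → t ≢ t0 →
  ∃[ t' ] (Star (AdjAvoid (T D) t0) t t' ×
    ∃[ v ] ((v ∈ Y D t') × (v ∉ Y D t0)))

{-# OPTIONS --safe #-}
-- Let c be a node of T. Each edge e of T at c leads to a branch of T - c, and by (W5) some vertex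
-- of G lies in a bag of that branch but not in Y c. Walking in G from it to a vertex of Y c
-- (nonempty, again by (W5) and connectivity), the bags chosen by (W1) for the edges of the walk
-- stay in the branch by (W2) until the walk first enters Y c; the edge doing so meets Y c and has
-- its bag in the branch. Distinct edges at c lead to distinct branches because T is acyclic, so
-- this injects the edges of T at c into the edges of G meeting Y c, of which there are at most
-- |Y c| d ≤ (w + 1) d.
module Submission where

open import Defs
open import Data.Empty using (⊥; ⊥-elim)
open import Data.Fin using (Fin; zero; suc; inject₁; fromℕ; toℕ; _≟_)
open import Data.Fin.Properties
  using (any?; suc-injective; inject₁-injective; toℕ-inject₁; fromℕ≢inject₁; injective⇒≤)
open import Data.Fin.Subset using (Subset; inside; outside; _∈_; _∉_; ∣_∣)
open import Data.Fin.Subset.Properties using (_∈?_)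
open import Data.List using (List; []; _∷_; length; map; filter; concatMap; allFin; lookup)
open import Data.List.Properties using (length-++; length-map)
open import Data.List.Membership.Propositional using () renaming (_∈_ to _∈ˡ_)
open import Data.List.Membership.Propositional.Properties
  using (∈-map⁺; ∈-concat⁺′; ∈-filter⁺; ∈-filter⁻; ∈-allFin; ∈-lookup)
open import Data.List.Membership.Setoid.Properties using (index-injective)
open import Data.List.Relation.Unary.All as All using ()
open import Data.List.Relation.Unary.AllPairs using (_∷_)
open import Data.List.Relation.Unary.Any using (here; there; index)
open import Data.List.Relation.Unary.Unique.Propositional using (Unique)
open import Data.List.Relation.Unary.Unique.Propositional.Properties using (allFin⁺; filter⁺)
open import Data.Nat using (ℕ; zero; suc; _*_; _≤_; _<_; z≤n)
open import Data.Nat.Properties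
  using (≤-reflexive; ≤-trans; +-mono-≤; *-monoˡ-≤; <-asym; module ≤-Reasoning)
open import Data.Product using (∃; ∃-syntax; _×_; _,_; proj₁; proj₂; swap)
open import Data.Product.Properties using (,-injective)
open import Data.Sum using (_⊎_; inj₁; inj₂)
open import Data.Vec.Base using ([]; _∷_; here; there)
open import Function using (_∘_)
open import Function.Definitions using (Injective)
open import Relation.Binary.PropositionalEquality
open import Relation.Binary.Construct.Closure.ReflexiveTransitive
  using (Star; ε; _◅_; _◅◅_; reverse; fold) renaming (map to mapStar)
open import Relation.Nullary using (¬_; yes; no)
open import Relation.Nullary.Decidable using (decidable-stable)

module _ {a} {A : Set a} where

  Unique-lookup-injective : ∀ {xs : List A} → Unique xs → Injective _≡_ _≡_ (lookup xs)
  Unique-lookup-injective (_ ∷ _)    {zero}  {zero}  _  = refl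
  Unique-lookup-injective (x∉xs ∷ _) {zero}  {suc j} eq = ⊥-elim (All.lookup x∉xs (∈-lookup j) eq)
  Unique-lookup-injective (x∉xs ∷ _) {suc i} {zero}  eq = ⊥-elim (All.lookup x∉xs (∈-lookup i) (sym eq))
  Unique-lookup-injective (_ ∷ xs!)  {suc i} {suc j} eq = cong suc (Unique-lookup-injective xs! eq)

module _ {a b} {A : Set a} {B : Set b} where

  length-≤-by-injection : ∀ {r} {xs : List A} {ys : List B} (R : A → B → Set r) → Unique xs →
    (∀ {x} → x ∈ˡ xs → ∃[ y ] y ∈ˡ ys × R x y) →
    (∀ {x x′ y} → R x y → R x′ y → x ≡ x′) →
    length xs ≤ length ys
  length-≤-by-injection {xs = xs} {ys} R xs! choose R-injective = injective⇒≤ position-injective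
    where
    chosen : Fin (length xs) → B
    chosen i = proj₁ (choose (∈-lookup i))

    chosen∈ys : ∀ i → chosen i ∈ˡ ys
    chosen∈ys i = proj₁ (proj₂ (choose (∈-lookup i)))

    R-chosen : ∀ i → R (lookup xs i) (chosen i)
    R-chosen i = proj₂ (proj₂ (choose (∈-lookup i)))

    position : Fin (length xs) → Fin (length ys)
    position i = index (chosen∈ys i)

    position-injective : Injective _≡_ _≡_ position
    position-injective {i} {j} eq =
      Unique-lookup-injective xs!
        (R-injective (R-chosen i) (subst (R (lookup xs j)) (sym same) (R-chosen j)))
      where
      same : chosen i ≡ chosen j
      same = index-injective (setoid B) (chosen∈ys i) (chosen∈ys j) eq

  length-concatMap-≤ : ∀ (f : A → List B) {d} → (∀ x → length (f x) ≤ d) →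
    ∀ xs → length (concatMap f xs) ≤ length xs * d
  length-concatMap-≤ f bound []       = z≤n
  length-concatMap-≤ f bound (x ∷ xs) =
    ≤-trans (≤-reflexive (length-++ (f x))) (+-mono-≤ (bound x) (length-concatMap-≤ f bound xs))

members : ∀ {n} → Subset n → List (Fin n)
members []            = []
members (inside ∷ p)  = zero ∷ map suc (members p)
members (outside ∷ p) = map suc (members p)

length-members : ∀ {n} (p : Subset n) → length (members p) ≡ ∣ p ∣
length-members []            = refl
length-members (inside ∷ p)  = cong suc (trans (length-map suc (members p)) (length-members p))
length-members (outside ∷ p) = trans (length-map suc (members p)) (length-members p)

∈-members : ∀ {n} {p : Subset n} {x} → x ∈ p → x ∈ˡ members p
∈-members                  here        = here refl
∈-members {p = inside ∷ _}  (there x∈p) = there (∈-map⁺ suc (∈-members x∈p))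
∈-members {p = outside ∷ _} (there x∈p) = ∈-map⁺ suc (∈-members x∈p)

module _ (G : Multigraph) where

  incidentEdges : Vertex G → List (Edge G)
  incidentEdges v = filter (incident? G v) (allFin (nE G))

  edgesMeeting : Subset (nV G) → List (Edge G)
  edgesMeeting S = concatMap incidentEdges (members S)

  length-edgesMeeting : ∀ {d} → MaxDegree≤ G d → ∀ S → length (edgesMeeting S) ≤ ∣ S ∣ * d
  length-edgesMeeting {d} Δ≤d S =
    subst (λ m → length (edgesMeeting S) ≤ m * d) (length-members S)
      (length-concatMap-≤ incidentEdges Δ≤d (members S))

  ∈-incidentEdges⁻ : ∀ {v g} → g ∈ˡ incidentEdges v → Incident G v g
  ∈-incidentEdges⁻ {v} = proj₂ ∘ ∈-filter⁻ (incident? G v) {xs = allFin (nE G)}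

  ∈-edgesMeeting : ∀ {S u g} → u ∈ S → Incident G u g → g ∈ˡ edgesMeeting S
  ∈-edgesMeeting u∈S u-g =
    ∈-concat⁺′ (∈-filter⁺ (incident? G _) (∈-allFin _) u-g) (∈-map⁺ incidentEdges (∈-members u∈S))

  Joins-sym : ∀ {g x y} → Joins G g x y → Joins G g y x
  Joins-sym (inj₁ p) = inj₂ p
  Joins-sym (inj₂ p) = inj₁ p

  Joins-irrefl : ∀ {g x} → ¬ Joins G g x x
  Joins-irrefl {g} (inj₁ p) = loopless G g (trans (cong proj₁ p) (sym (cong proj₂ p)))
  Joins-irrefl {g} (inj₂ p) = loopless G g (trans (cong proj₁ p) (sym (cong proj₂ p)))

  Joins-unique : ∀ {g x y x′ y′} → Joins G g x y → Joins G g x′ y′ →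
    (x ≡ x′ × y ≡ y′) ⊎ (x ≡ y′ × y ≡ x′)
  Joins-unique (inj₁ p) (inj₁ q) = inj₁ (,-injective (trans (sym p) q))
  Joins-unique (inj₁ p) (inj₂ q) = inj₂ (,-injective (trans (sym p) q))
  Joins-unique (inj₂ p) (inj₁ q) = inj₂ (swap (,-injective (trans (sym p) q)))
  Joins-unique (inj₂ p) (inj₂ q) = inj₁ (swap (,-injective (trans (sym p) q)))

  Joins⇒Incidentʳ : ∀ {g x y} → Joins G g x y → Incident G y g
  Joins⇒Incidentʳ (inj₁ p) = inj₂ (cong proj₂ p)
  Joins⇒Incidentʳ (inj₂ p) = inj₁ (cong proj₁ p)

  Incident⇒Joins : ∀ {x g} → Incident G x g → ∃[ y ] Joins G g x y × y ≢ x
  Incident⇒Joins {g = g} (inj₁ p) =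
    proj₂ (ends G g) , inj₁ (cong (_, proj₂ (ends G g)) p) , λ q → loopless G g (trans p (sym q))
  Incident⇒Joins {g = g} (inj₂ p) =
    proj₁ (ends G g) , inj₂ (cong (proj₁ (ends G g) ,_) p) , λ q → loopless G g (trans q (sym p))

  AdjExcept : Edge G → Vertex G → Vertex G → Set
  AdjExcept e x y = ∃[ g ] g ≢ e × Joins G g x y

  AdjAvoid-sym : ∀ {c x y} → AdjAvoid G c x y → AdjAvoid G c y x
  AdjAvoid-sym ((g , g-xy) , x≢c , y≢c) = (g , Joins-sym g-xy) , y≢c , x≢c

  AdjAvoid⇒AdjExcept : ∀ {e c n x y} → Joins G e c n → AdjAvoid G c x y → AdjExcept e x y
  AdjAvoid⇒AdjExcept {e} e-cn ((g , g-xy) , x≢c , y≢c) = g , g≢e , g-xy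
    where
    g≢e : g ≢ e
    g≢e refl with Joins-unique g-xy e-cn
    ... | inj₁ (x≡c , _) = x≢c x≡c
    ... | inj₂ (_ , y≡c) = y≢c y≡c

-- Path from Defs, generalised to any relation so that walks avoiding an edge can be shortened too.
record SimplePath {n} (R : Fin n → Fin n → Set) (a b : Fin n) : Set where
  constructor simplePath
  field
    k : ℕ
    ps : Fin (suc k) → Fin n
    ps-inj : Injective _≡_ _≡_ ps
    start : ps zero ≡ a
    end : ps (fromℕ k) ≡ b
    step : ∀ (i : Fin k) → R (ps (inject₁ i)) (ps (suc i))

module _ {n} {R : Fin n → Fin n → Set} where

  open SimplePath

  trivialPath : ∀ {a} → SimplePath R a a
  trivialPath {a} = simplePath 0 (λ _ → a) (λ { {zero} {zero} _ → refl }) refl refl (λ ())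

  suffix : ∀ {a b} (P : SimplePath R a b) (i : Fin (suc (k P))) → SimplePath R (ps P i) b
  suffix P zero = simplePath (k P) (ps P) (ps-inj P) refl (end P) (step P)
  suffix (simplePath zero _ _ _ _ _) (suc ())
  suffix (simplePath (suc k) ps ps-inj _ end step) (suc i) =
    suffix (simplePath k (ps ∘ suc) (suc-injective ∘ ps-inj) refl end (step ∘ suc)) i

  prepend : ∀ {a c b} → R a c → (P : SimplePath R c b) → (∀ i → ps P i ≢ a) → SimplePath R a b
  prepend {a} r (simplePath k ps ps-inj start end step) a∉P =
    simplePath (suc k) ps′ ps′-inj refl end step′
    where
    ps′ : Fin (suc (suc k)) → Fin n
    ps′ zero    = a
    ps′ (suc i) = ps i

    ps′-inj : Injective _≡_ _≡_ ps′
    ps′-inj {zero}  {zero}  _  = refl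
    ps′-inj {zero}  {suc j} eq = ⊥-elim (a∉P j (sym eq))
    ps′-inj {suc i} {zero}  eq = ⊥-elim (a∉P i eq)
    ps′-inj {suc i} {suc j} eq = cong suc (ps-inj eq)

    step′ : ∀ (i : Fin (suc k)) → R (ps′ (inject₁ i)) (ps′ (suc i))
    step′ zero    = subst (R a) (sym start) r
    step′ (suc i) = step i

  _◅ₚ_ : ∀ {a c b} → R a c → SimplePath R c b → SimplePath R a b
  _◅ₚ_ {a} {b = b} r P with any? (λ i → ps P i ≟ a)
  ... | yes (i , Pᵢ≡a) = subst (λ x → SimplePath R x b) Pᵢ≡a (suffix P i)
  ... | no a∉P        = prepend r P (λ i Pᵢ≡a → a∉P (i , Pᵢ≡a))

  walk⇒path : ∀ {a b} → Star R a b → SimplePath R a b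
  walk⇒path = fold (SimplePath R) _◅ₚ_ trivialPath

  path⇒walk-within : ∀ {a b} {Q : Fin n → Set} (P : SimplePath R a b) → (∀ i → Q (ps P i)) →
    Star (λ x y → R x y × Q x × Q y) a b
  path⇒walk-within {b = b} {Q} P Q-ps =
    subst (λ x → Star _ x b) (start P) (walk-from (k P) (ps P) (end P) (step P) Q-ps)
    where
    walk-from : ∀ k (ps : Fin (suc k) → Fin n) → ps (fromℕ k) ≡ b →
      (∀ i → R (ps (inject₁ i)) (ps (suc i))) → (∀ i → Q (ps i)) →
      Star (λ x y → R x y × Q x × Q y) (ps zero) b
    walk-from zero    ps end _    _    = subst (Star _ (ps zero)) end ε
    walk-from (suc k) ps end step Q-ps =
      (step zero , Q-ps zero , Q-ps (suc zero)) ◅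
      walk-from k (ps ∘ suc) end (step ∘ suc) (Q-ps ∘ suc)

toPath : ∀ {G : Multigraph} {a b} → SimplePath (Adj G) a b → Path G a b
toPath (simplePath k ps ps-inj start end step) = record
  { k = k ; ps = ps ; ps-inj = ps-inj ; start = start ; end = end ; step = step }

module _ (G : Multigraph) where

  open SimplePath

  path-edges-injective : ∀ {e a b} (P : SimplePath (AdjExcept G e) a b) →
    Injective _≡_ _≡_ (λ i → proj₁ (step P i))
  path-edges-injective P {i} {j} eq
    with Joins-unique G (proj₂ (proj₂ (step P i)))
                        (subst (λ g → Joins G g _ _) (sym eq) (proj₂ (proj₂ (step P j))))
  ... | inj₁ (same-start , _) = inject₁-injective (ps-inj P same-start)
  ... | inj₂ (iʳ≡jˡ , iˡ≡jʳ)  = ⊥-elim (<-asym j<i i<j)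
    where
    j<i : toℕ j < toℕ i
    j<i = ≤-reflexive (trans (sym (cong toℕ (ps-inj P iʳ≡jˡ))) (toℕ-inject₁ i))
    i<j : toℕ i < toℕ j
    i<j = ≤-reflexive (trans (cong toℕ (ps-inj P iˡ≡jʳ)) (toℕ-inject₁ j))

  -- e comes first, from a to P₀ = b, and the last edge of P, into a, closes the cycle: with this
  -- rotation every index of Cycle computes definitionally.
  edge+path⇒cycle : ∀ {e a b} → Joins G e a b → SimplePath (AdjExcept G e) b a → Cycle G
  edge+path⇒cycle e-ab (simplePath zero ps _ start end _) =
    ⊥-elim (Joins-irrefl G (subst (Joins G _ _) (trans (sym start) end) e-ab))
  edge+path⇒cycle {e} {a} e-ab P@(simplePath (suc m) ps ps-inj start end step) = record
    { k = m ; vs = vs ; es = es ; vs-inj = vs-inj ; es-inj = es-inj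
    ; step  = λ { zero    → subst (Joins G e a) (sym start) e-ab
                ; (suc i) → proj₂ (proj₂ (step (inject₁ i))) }
    ; close = subst (Joins G _ _) end (proj₂ (proj₂ (step (fromℕ m)))) }
    where
    vs : Fin (suc (suc m)) → Vertex G
    vs zero    = a
    vs (suc i) = ps (inject₁ i)

    es : Fin (suc (suc m)) → Edge G
    es zero    = e
    es (suc i) = proj₁ (step i)

    vs-inj : Injective _≡_ _≡_ vs
    vs-inj {zero}  {zero}  _  = refl
    vs-inj {zero}  {suc j} eq = ⊥-elim (fromℕ≢inject₁ (ps-inj (trans end eq)))
    vs-inj {suc i} {zero}  eq = ⊥-elim (fromℕ≢inject₁ (ps-inj (trans end (sym eq))))
    vs-inj {suc i} {suc j} eq = cong suc (inject₁-injective (ps-inj eq))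

    es-inj : Injective _≡_ _≡_ es
    es-inj {zero}  {zero}  _  = refl
    es-inj {zero}  {suc j} eq = ⊥-elim (proj₁ (proj₂ (step j)) (sym eq))
    es-inj {suc i} {zero}  eq = ⊥-elim (proj₁ (proj₂ (step i)) eq)
    es-inj {suc i} {suc j} eq = cong suc (path-edges-injective P eq)

  no-bypass : ¬ Cycle G → ∀ {e a b} → Joins G e a b → ¬ Star (AdjExcept G e) b a
  no-bypass acyclic e-ab = acyclic ∘ edge+path⇒cycle e-ab ∘ walk⇒path

module Branches {G : Multigraph} (D : TreeDecomposition G) where

  Branch : Vertex (T D) → Vertex (T D) → Vertex (T D) → Set
  Branch c = Star (AdjAvoid (T D) c)

  Branch-sym : ∀ {c a b} → Branch c a b → Branch c b a
  Branch-sym = reverse (AdjAvoid-sym (T D))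

  shared⇒sameBranch : ∀ {c a b x} → x ∉ Y D c → x ∈ Y D a → x ∈ Y D b → Branch c a b
  shared⇒sameBranch {c} {a} {b} {x} x∉c x∈a x∈b =
    path⇒walk-within {Q = _≢ c} P λ i Pᵢ≡c →
      x∉c (W2 D a b (toPath {G = T D} P) c (i , Pᵢ≡c) x x∈a x∈b)
    where
    P : SimplePath (Adj (T D)) a b
    P = walk⇒path (proj₂ (proj₁ (T-tree D)) a b)

  branches-separate : ∀ {c n e t} → Joins (T D) e c n → Branch c n t → Branch n t c → ⊥
  branches-separate e-cn n~t t~c = no-bypass (T D) (proj₂ (T-tree D)) e-cn
    (mapStar (AdjAvoid⇒AdjExcept (T D) e-cn) n~t ◅◅
     mapStar (AdjAvoid⇒AdjExcept (T D) (Joins-sym (T D) e-cn)) t~c)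

  sameBranch⇒sameEdge : ∀ {c n n′ e e′} → Joins (T D) e c n → Joins (T D) e′ c n′ →
    Branch c n n′ → e ≡ e′
  sameBranch⇒sameEdge {e = e} {e′} e-cn e′-cn′ n~n′ = decidable-stable (e ≟ e′) λ e≢e′ →
    no-bypass (T D) (proj₂ (T-tree D)) e-cn
      (mapStar (AdjAvoid⇒AdjExcept (T D) e-cn) n~n′ ◅◅
       (e′ , e≢e′ ∘ sym , Joins-sym (T D) e′-cn′) ◅ ε)

module Attachments {G : Multigraph} (D : TreeDecomposition G) where

  open Branches D

  bagOf : Edge G → Vertex (T D)
  bagOf g = proj₁ (W1-edges D g)

  private
    BothIn : Subset (nV G) → Vertex G × Vertex G → Set
    BothIn S (x , y) = x ∈ S × y ∈ S

  Joins⇒∈bagOf : ∀ {g x y} → Joins G g x y → x ∈ Y D (bagOf g) × y ∈ Y D (bagOf g)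
  Joins⇒∈bagOf {g} (inj₁ p) = subst (BothIn (Y D (bagOf g))) p (proj₂ (W1-edges D g))
  Joins⇒∈bagOf {g} (inj₂ p) = swap (subst (BothIn (Y D (bagOf g))) p (proj₂ (W1-edges D g)))

  InBranch : Vertex (T D) → Vertex (T D) → Vertex G → Set
  InBranch c n x = x ∉ Y D c × ∃[ t ] x ∈ Y D t × Branch c n t

  Attaches : Vertex (T D) → Vertex (T D) → Edge G → Set
  Attaches c n g = (∃[ y ] Incident G y g × y ∈ Y D c) × Branch c n (bagOf g)

  bagOf-inBranch : ∀ {c n g x y} → Joins G g x y → InBranch c n x → Branch c n (bagOf g)
  bagOf-inBranch g-xy (x∉c , t , x∈t , n~t) =
    n~t ◅◅ shared⇒sameBranch x∉c x∈t (proj₁ (Joins⇒∈bagOf g-xy))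

  walk-attaches-or-stays : ∀ {c n x z} → Star (Adj G) x z → InBranch c n x →
    ∃ (Attaches c n) ⊎ InBranch c n z
  walk-attaches-or-stays ε x-in = inj₂ x-in
  walk-attaches-or-stays {c} ((g , g-xy) ◅ w) x-in with _ ∈? Y D c
  ... | yes y∈c = inj₁ (g , (_ , Joins⇒Incidentʳ G g-xy , y∈c) , bagOf-inBranch g-xy x-in)
  ... | no y∉c  =
    walk-attaches-or-stays w (y∉c , bagOf g , proj₂ (Joins⇒∈bagOf g-xy) , bagOf-inBranch g-xy x-in)

  Represents : Vertex (T D) → Edge (T D) → Edge G → Set
  Represents c e g = ∃[ n ] Joins (T D) e c n × Attaches c n g

  Represents-injective : ∀ {c e e′ g} → Represents c e g → Represents c e′ g → e ≡ e′
  Represents-injective (_ , e-cn , _ , n~g) (_ , e′-cn′ , _ , n′~g) =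
    sameBranch⇒sameEdge e-cn e′-cn′ (n~g ◅◅ Branch-sym n′~g)

  module _ (connected : Connected G) (w5 : W5 D) where

    nonempty-bag : ∀ {e c n} → Joins (T D) e c n → n ≢ c → ∃[ u ] u ∈ Y D c
    -- If Y c were empty, a walk in G from n's side of c to c's side of n would join the two
    -- sides of e in T.
    nonempty-bag {c = c} {n} e-cn n≢c with any? (_∈? Y D c)
    ... | yes u∈c = u∈c
    ... | no Yc-empty with w5 c n n≢c | w5 n c (n≢c ∘ sym)
    ... | t , n~t , v , v∈t , v∉c | t′ , c~t′ , v′ , v′∈t′ , v′∉n
        with walk-attaches-or-stays (proj₂ connected v v′) (v∉c , t , v∈t , n~t)
    ... | inj₁ (_ , (y , _ , y∈c) , _)  = ⊥-elim (Yc-empty (y , y∈c))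
    ... | inj₂ (_ , t″ , v′∈t″ , n~t″) =
          ⊥-elim (branches-separate e-cn n~t″
                   (shared⇒sameBranch v′∉n v′∈t″ v′∈t′ ◅◅ Branch-sym c~t′))

    attaching-edge : ∀ {e c n} → Joins (T D) e c n → n ≢ c → ∃ (Attaches c n)
    attaching-edge e-cn n≢c with nonempty-bag e-cn n≢c | w5 _ _ n≢c
    ... | u , u∈c | t , n~t , v , v∈t , v∉c
        with walk-attaches-or-stays (proj₂ connected v u) (v∉c , t , v∈t , n~t)
    ... | inj₁ attaches  = attaches
    ... | inj₂ (u∉c , _) = ⊥-elim (u∉c u∈c)

    representative : ∀ {c e} → e ∈ˡ incidentEdges (T D) c →
      ∃[ g ] g ∈ˡ edgesMeeting G (Y D c) × Represents c e g
    representative e∈ with Incident⇒Joins (T D) (∈-incidentEdges⁻ (T D) e∈)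
    ... | n , e-cn , n≢c with attaching-edge e-cn n≢c
    ... | g , attaches@((_ , y-g , y∈c) , _) = g , ∈-edgesMeeting G y∈c y-g , n , e-cn , attaches

mainTheorem6 : (G : Multigraph) (d w : ℕ) → Connected G → MaxDegree≤ G d →
    (D : TreeDecomposition G) → Width≤ D w → W5 D →
    MaxDegree≤ (T D) (suc w * d)
mainTheorem6 G d w connected Δ≤d D width≤w w5 c = begin
  degree (T D) c                  ≤⟨ length-≤-by-injection (Represents c) incidentEdges-unique
                                       (representative connected w5) Represents-injective ⟩
  length (edgesMeeting G (Y D c)) ≤⟨ length-edgesMeeting G Δ≤d (Y D c) ⟩
  ∣ Y D c ∣ * d                   ≤⟨ *-monoˡ-≤ d (width≤w c) ⟩
  suc w * d                       ∎
  where
  open ≤-Reasoning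
  open Attachments D
  incidentEdges-unique : Unique (incidentEdges (T D) c)
  incidentEdges-unique = filter⁺ (incident? (T D) c) {allFin (nE (T D))} (allFin⁺ (nE (T D)))
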